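{- If a mini-gringo program $\Pi$ is tight, then every io-program of the form $(\Pi,\mathit{PH},\mathit{In},\mathit{Out})$ is locally tight for all inputs.
   Context: Mini-gringo syntax. Fix disjoint countably infinite sets of numerals, symbolic constants and variables; $\overline n$ is the numeral for the integer $n$. Precomputed terms are numerals and symbolic constants, totally ordered so that $\overline m<\overline n$ iff $m<n$. Terms are built from precomputed terms and variables with $|\cdot|$ and binary $+,-,\times,/,\backslash,..$. An atom is $p(t_1,\dots,t_n)$ ($p$ a symbolic constant); $p/n$ is its predicate symbol. Literals: $A$, $\mathit{not}\ A$, $\mathit{not}\ \mathit{not}\ A$ for an atom $A$. Comparisons: $t_1\prec t_2$ with $\prec$ among $=,\neq,<,>,\le,\ge$. A rule is $\mathit{Head}\leftarrow\mathit{Body}$, $\mathit{Body}$ a possibly empty conjunction of literals and comparisons, $\mathit{Head}$ an atom (basic rule), $\{A\}$ for an atom $A$ (choice rule), or empty (constraint). A program is a finite set of rules. Instances (ground instances) of a rule are obtained by substituting precomputed terms for its variables. Values of ground terms: $[t]=\{t\}$ for precomputed $t$; $[|t_1|]=\{\overline{|n|}:\overline n\in[t_1]\}$; $[t_1\,\mathit{op}\,t_2]=\{\overline{n_1\,\mathit{op}\,n_2}:\overline{n_i}\in[t_i]\}$ for $\mathit{op}\in\{+,-,\times\}$; $[t_1/t_2]=\{\overline{\mathit{round}(n_1/n_2)}:\overline{n_i}\in[t_i],n_2\ne0\}$; $[t_1\backslash t_2]=\{\overline{n_1-n_2\,\mathit{round}(n_1/n_2)}:\overline{n_i}\in[t_i],n_2\ne0\}$;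 $[t_1..t_2]=\{\overline m:n_1\le m\le n_2,\overline{n_i}\in[t_i]\}$, with $\mathit{round}$ truncating toward zero. For tuples, $[\mathbf t]$ is the set of tuples $\mathbf r$ with $r_i\in[t_i]$. Tightness. The positive predicate dependency graph of $\Pi$ has as vertices the predicate symbols occurring in $\Pi$ and an edge from $p/n$ to $p'/n'$ iff $p/n$ occurs in the head of a rule $R$ of $\Pi$ such that $p'/n'$ occurs in an atom that is a conjunctive term of the body of $R$. $\Pi$ is tight if this graph is acyclic. IO-programs. An io-program is $(\Pi,\mathit{PH},\mathit{In},\mathit{Out})$ where $\mathit{PH}$ is a finite set of symbolic constants (placeholders), $\mathit{In},\mathit{Out}$ are disjoint finite sets of predicate symbols (input and output symbols), and $\Pi$ is a program with no input symbol in rule heads. Private symbols are the predicate symbols occurring in $\Pi$ that are neither input nor output symbols. A valuation $v$ on $\mathit{PH}$ maps each placeholder to a precomputed term not in $\mathit{PH}$; an input is $(v,\mathcal I)$ with $v$ a valuation on $\mathit{PH}$ and $\mathcal I$ a set of precomputed atoms with input predicate symbols not containing placeholders. $v(\Pi)$ is obtained by replacing each $c\in\mathit{PH}$ by $v(c)$. Positive dependency graph of $\Omega$ for input $(v,\mathcal I)$: vertices are ground atoms $p(r_1,\dots,r_n)$ with $p/n$ an output or private symbol and each $r_i$ a precomputed term not in $\mathit{PH}$; there is an edge from $p(\mathbf r)$ to $p'(\mathbf r')$ iff some ground instance $R$ of a rule of $v(\Pi)$ satisfies: (a) the head of $R$ is $p(\mathbf t)$ or $\{p(\mathbf t)\}$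 with $\mathbf r\in[\mathbf t]$; (b) the body of $R$ has a conjunctive term $p'(\mathbf t)$ with $\mathbf r'\in[\mathbf t]$; (c) for every conjunctive term of the body containing an input symbol and of the form $q(\mathbf t)$ or $\mathit{not}\ \mathit{not}\ q(\mathbf t)$, some $\mathbf r''\in[\mathbf t]$ has $q(\mathbf r'')\in\mathcal I$; (d) for every conjunctive term containing an input symbol of the form $\mathit{not}\ q(\mathbf t)$, some $\mathbf r''\in[\mathbf t]$ has $q(\mathbf r'')\notin\mathcal I$; (e) for every comparison $t_1\prec t_2$ in the body there are $r_1\in[t_1],r_2\in[t_2]$ with $r_1\prec r_2$. The io-program is locally tight on $(v,\mathcal I)$ if this graph has no infinite walk (infinite sequence of edges joining consecutive vertices). -}

module Defs where

open import Data.Nat as ℕ using (ℕ; suc)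
open import Data.Integer as ℤ using (ℤ; +_; -[1+_]; ∣_∣; sign; _◃_)
import Data.Sign as Sign
open import Data.List using (List; []; _∷_; length)
open import Data.List.Membership.Propositional using (_∈_)
open import Data.List.Relation.Unary.Any using (Any)
open import Data.List.Relation.Binary.Pointwise using (Pointwise)
open import Data.Product using (Σ; ∃; ∃-syntax; _×_; _,_)
open import Data.Sum using (_⊎_)
open import Data.Empty using (⊥)
open import Data.Unit using (⊤)
open import Relation.Nullary using (¬_)
open import Relation.Binary.PropositionalEquality using (_≡_; _≢_)
open import Relation.Binary.Construct.Closure.Transitive using (TransClosure)

-- Symbolic constants and variables are both represented by ℕ
-- (countably infinite, disjoint by living in different constructors);
-- numerals are represented by ℤ.
SymConst : Set
SymConst = ℕ

Var : Set
Var = ℕ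

data PTerm : Set where
  num : ℤ → PTerm
  sym : SymConst → PTerm

data _<ᵖ_ : PTerm → PTerm → Set where
  num<num : ∀ {m n} → m ℤ.< n → num m <ᵖ num n
  num<sym : ∀ {m c} → num m <ᵖ sym c
  sym<sym : ∀ {c d} → c ℕ.< d → sym c <ᵖ sym d

data BinOp : Set where
  plus minus times div mod interval : BinOp

data Term : Set where
  pre : PTerm → Term
  var : Var → Term
  abs : Term → Term
  bin : BinOp → Term → Term → Term

record Atom : Set where
  constructor _⟨_⟩
  field
    name : SymConst
    args : List Term

PredSym : Set
PredSym = SymConst × ℕ

predSym : Atom → PredSym
predSym (p ⟨ ts ⟩) = p , length ts

data Literal : Set where
  pos    : Atom → Literal
  neg    : Atom → Literal
  negneg : Atom → Literal

data Rel : Set where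
  eq neq lt gt le ge : Rel

data BodyElem : Set where
  lit  : Literal → BodyElem
  comp : Rel → Term → Term → BodyElem

Body : Set
Body = List BodyElem

data Head : Set where
  basic  : Atom → Head
  choice : Atom → Head
  none   : Head

record Rule : Set where
  constructor _←_
  field
    head : Head
    body : Body

Program : Set
Program = List Rule

Subst : Set
Subst = Var → PTerm

module MapTerm (f : Term → Term) where
  atom : Atom → Atom
  atom (p ⟨ ts ⟩) = p ⟨ Data.List.map f ts ⟩

  literal : Literal → Literal
  literal (pos a) = pos (atom a)
  literal (neg a) = neg (atom a)
  literal (negneg a) = negneg (atom a)

  bodyElem : BodyElem → BodyElem
  bodyElem (lit l) = lit (literal l)
  bodyElem (comp r t u) = comp r (f t) (f u)

  head : Head → Head
  head (basic a) = basic (atom a)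
  head (choice a) = choice (atom a)
  head none = none

  rule : Rule → Rule
  rule (h ← b) = head h ← Data.List.map bodyElem b

substTerm : Subst → Term → Term
substTerm σ (pre t) = pre t
substTerm σ (var x) = pre (σ x)
substTerm σ (abs t) = abs (substTerm σ t)
substTerm σ (bin o t u) = bin o (substTerm σ t) (substTerm σ u)

instRule : Subst → Rule → Rule
instRule σ = MapTerm.rule (substTerm σ)

GroundInstance : Program → Rule → Set
GroundInstance Π R = ∃[ ρ ] (ρ ∈ Π × ∃[ σ ] (R ≡ instRule σ ρ))

-- integer division rounding toward zero (second argument ≠ 0 when used)
tquot : ℤ → ℤ → ℤ
tquot i (+ 0)      = + 0
tquot i (+ suc k)  = (sign i Sign.* Sign.+) ◃ (∣ i ∣ ℕ./ suc k)
tquot i -[1+ k ]   = (sign i Sign.* Sign.-) ◃ (∣ i ∣ ℕ./ suc k)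

-- r ∈⟦ t ⟧ : r belongs to the set of values [t] of the (ground) term t.
-- Non-ground terms (variables) have no values.
_∈⟦_⟧ : PTerm → Term → Set
r ∈⟦ pre t ⟧ = r ≡ t
r ∈⟦ var x ⟧ = ⊥
r ∈⟦ abs t ⟧ = ∃[ n ] (num n ∈⟦ t ⟧ × r ≡ num (+ ∣ n ∣))
r ∈⟦ bin plus t u ⟧ =
  ∃[ n₁ ] ∃[ n₂ ] (num n₁ ∈⟦ t ⟧ × num n₂ ∈⟦ u ⟧ × r ≡ num (n₁ ℤ.+ n₂))
r ∈⟦ bin minus t u ⟧ =
  ∃[ n₁ ] ∃[ n₂ ] (num n₁ ∈⟦ t ⟧ × num n₂ ∈⟦ u ⟧ × r ≡ num (n₁ ℤ.- n₂))
r ∈⟦ bin times t u ⟧ =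
  ∃[ n₁ ] ∃[ n₂ ] (num n₁ ∈⟦ t ⟧ × num n₂ ∈⟦ u ⟧ × r ≡ num (n₁ ℤ.* n₂))
r ∈⟦ bin div t u ⟧ =
  ∃[ n₁ ] ∃[ n₂ ] (num n₁ ∈⟦ t ⟧ × num n₂ ∈⟦ u ⟧ × n₂ ≢ + 0
                   × r ≡ num (tquot n₁ n₂))
r ∈⟦ bin mod t u ⟧ =
  ∃[ n₁ ] ∃[ n₂ ] (num n₁ ∈⟦ t ⟧ × num n₂ ∈⟦ u ⟧ × n₂ ≢ + 0
                   × r ≡ num (n₁ ℤ.- n₂ ℤ.* tquot n₁ n₂))
r ∈⟦ bin interval t u ⟧ =
  ∃[ n₁ ] ∃[ n₂ ] ∃[ m ] (num n₁ ∈⟦ t ⟧ × num n₂ ∈⟦ u ⟧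
                          × n₁ ℤ.≤ m × m ℤ.≤ n₂ × r ≡ num m)

_∈⟦_⟧* : List PTerm → List Term → Set
rs ∈⟦ ts ⟧* = Pointwise _∈⟦_⟧ rs ts

holds : Rel → PTerm → PTerm → Set
holds eq  r s = r ≡ s
holds neq r s = r ≢ s
holds lt  r s = r <ᵖ s
holds gt  r s = s <ᵖ r
holds le  r s = r <ᵖ s ⊎ r ≡ s
holds ge  r s = s <ᵖ r ⊎ r ≡ s

headAtoms : Head → List Atom
headAtoms (basic a)  = a ∷ []
headAtoms (choice a) = a ∷ []
headAtoms none       = []

litAtom : Literal → Atom
litAtom (pos a) = a
litAtom (neg a) = a
litAtom (negneg a) = a

bodyAtoms : Body → List Atom
bodyAtoms [] = []
bodyAtoms (lit l ∷ b) = litAtom l ∷ bodyAtoms b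
bodyAtoms (comp _ _ _ ∷ b) = bodyAtoms b

OccursIn : PredSym → Program → Set
OccursIn s Π = ∃[ ρ ] (ρ ∈ Π × ∃[ a ]
  ((a ∈ headAtoms (Rule.head ρ) ⊎ a ∈ bodyAtoms (Rule.body ρ)) × predSym a ≡ s))

PredEdge : Program → PredSym → PredSym → Set
PredEdge Π s s' = OccursIn s Π × OccursIn s' Π ×
  ∃[ ρ ] (ρ ∈ Π × ∃[ a ] (a ∈ headAtoms (Rule.head ρ) × predSym a ≡ s)
                × ∃[ a' ] (lit (pos a') ∈ Rule.body ρ × predSym a' ≡ s'))

Tight : Program → Set
Tight Π = ∀ s → ¬ TransClosure (PredEdge Π) s s

InPH : List SymConst → PTerm → Set
InPH PH (num _) = ⊥
InPH PH (sym c) = c ∈ PH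

NoInputInHeads : Program → List PredSym → Set
NoInputInHeads Π In = ∀ ρ a → ρ ∈ Π → a ∈ headAtoms (Rule.head ρ) → ¬ (predSym a ∈ In)

DisjointSyms : List PredSym → List PredSym → Set
DisjointSyms In Out = ∀ s → s ∈ In → ¬ (s ∈ Out)

record IOProgram : Set where
  field
    prog : Program
    PH   : List SymConst
    In   : List PredSym
    Out  : List PredSym
    disjoint   : DisjointSyms In Out
    noInHeads  : NoInputInHeads prog In

record GAtom : Set where
  constructor _⟨_⟩ᵍ
  field
    name : SymConst
    args : List PTerm

gpredSym : GAtom → PredSym
gpredSym (p ⟨ rs ⟩ᵍ) = p , length rs

-- valuation on PH: each placeholder goes to a precomputed term not in PH
-- (values on non-placeholders are irrelevant)
Valuation : List SymConst → (SymConst → PTerm) → Set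
Valuation PH v = ∀ c → c ∈ PH → ¬ InPH PH (v c)

InputSet : List SymConst → List PredSym → (GAtom → Set) → Set
InputSet PH In ℐ = ∀ A → ℐ A →
  gpredSym A ∈ In × ∀ r → r ∈ GAtom.args A → ¬ InPH PH r

module _ (PH : List SymConst) (v : SymConst → PTerm) where
  open import Data.List.Membership.DecPropositional ℕ._≟_ using (_∈?_)
  open import Relation.Nullary using (yes; no)

  replPH : Term → Term
  replPH (pre (num n)) = pre (num n)
  replPH (pre (sym c)) with c ∈? PH
  ... | yes _ = pre (v c)
  ... | no  _ = pre (sym c)
  replPH (var x) = var x
  replPH (abs t) = abs (replPH t)
  replPH (bin o t u) = bin o (replPH t) (replPH u)

  applyVal : Program → Program
  applyVal = Data.List.map (MapTerm.rule replPH)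

module LocalTightness (Ω : IOProgram) (v : SymConst → PTerm) (ℐ : GAtom → Set) where
  open IOProgram Ω

  Private : PredSym → Set
  Private s = OccursIn s prog × ¬ (s ∈ In) × ¬ (s ∈ Out)

  Vertex : GAtom → Set
  Vertex A = (gpredSym A ∈ Out ⊎ Private (gpredSym A))
           × (∀ r → r ∈ GAtom.args A → ¬ InPH PH r)

  IsInput : Atom → Set
  IsInput a = predSym a ∈ In

  BodyCond : BodyElem → Set
  BodyCond (lit (pos (q ⟨ ts ⟩))) =
    IsInput (q ⟨ ts ⟩) → ∃[ rs ] (rs ∈⟦ ts ⟧* × ℐ (q ⟨ rs ⟩ᵍ))
  BodyCond (lit (negneg (q ⟨ ts ⟩))) =
    IsInput (q ⟨ ts ⟩) → ∃[ rs ] (rs ∈⟦ ts ⟧* × ℐ (q ⟨ rs ⟩ᵍ))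
  BodyCond (lit (neg (q ⟨ ts ⟩))) =
    IsInput (q ⟨ ts ⟩) → ∃[ rs ] (rs ∈⟦ ts ⟧* × ¬ ℐ (q ⟨ rs ⟩ᵍ))
  BodyCond (comp ≺ t₁ t₂) = ∃[ r₁ ] ∃[ r₂ ] (r₁ ∈⟦ t₁ ⟧ × r₂ ∈⟦ t₂ ⟧ × holds ≺ r₁ r₂)

  HeadCond : Head → GAtom → Set
  HeadCond (basic (p ⟨ ts ⟩)) (p' ⟨ rs ⟩ᵍ) = p ≡ p' × rs ∈⟦ ts ⟧*
  HeadCond (choice (p ⟨ ts ⟩)) (p' ⟨ rs ⟩ᵍ) = p ≡ p' × rs ∈⟦ ts ⟧*
  HeadCond none _ = ⊥

  Edge : GAtom → GAtom → Set
  Edge A B = Vertex A × Vertex B ×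
    ∃[ R ] (GroundInstance (applyVal PH v prog) R
      × HeadCond (Rule.head R) A
      × ∃[ ts ] (lit (pos (GAtom.name B ⟨ ts ⟩)) ∈ Rule.body R
                 × GAtom.args B ∈⟦ ts ⟧*)
      × (∀ e → e ∈ Rule.body R → BodyCond e))

  LocallyTight : Set
  LocallyTight = ¬ (Σ (ℕ → GAtom) λ f → ∀ i → Edge (f i) (f (suc i)))

-- An edge p(r) → p'(r') of the ground dependency graph comes from a ground
-- instance of a rule of v(Π), and neither v(·) nor grounding changes predicate
-- symbols, so it projects to an edge p/n → p'/n' of the predicate dependency
-- graph of Π. An infinite walk thus projects to an infinite walk through the
-- finitely many predicate symbols of Π; by pigeonhole it revisits a symbol,
-- which closes a cycle and contradicts tightness.
module Submission where

open import Defs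
open import Data.List using (List)
open import Data.Product using (_×_)
open import Relation.Binary.PropositionalEquality using (_≡_)

open import Data.Nat using (ℕ; suc; _<_; s≤s)
open import Data.Nat.Properties using (n<1+n; m≤n⇒m<n∨m≡n)
open import Data.Fin using (toℕ)
open import Data.Fin.Properties using (pigeonhole)
open import Data.List using (_∷_; _++_; length; lookup; map; concatMap)
open import Data.List.Membership.Propositional using (_∈_; lose)
open import Data.List.Membership.Propositional.Properties
  using (∈-map⁺; ∈-map⁻; ∈-++⁺ˡ; ∈-++⁺ʳ; ∈-concatMap⁺)
open import Data.List.Properties using (length-map)
open import Data.List.Relation.Unary.Any using (here; there; index)
open import Data.List.Relation.Unary.Any.Properties using (lookup-index)
open import Data.List.Relation.Binary.Pointwise using (Pointwise-length)
open import Data.Product using (∃-syntax; ∃₂; _,_; proj₁)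
open import Data.Sum using (_⊎_; inj₁; inj₂)
open import Function using (_∘_)
open import Relation.Binary.PropositionalEquality using (refl; trans; cong; subst; module ≡-Reasoning)
  renaming (sym to ≡-sym)
open import Relation.Binary.Construct.Closure.Transitive using (TransClosure; [_]; _∷ʳ_)

module _ {A : Set} {E : A → A → Set} (g : ℕ → A) (walk : ∀ i → E (g i) (g (suc i))) where

  walk-segment : ∀ {i j} → i < j → TransClosure E (g i) (g j)
  walk-segment {i} {suc j} (s≤s i≤j) with m≤n⇒m<n∨m≡n i≤j
  ... | inj₁ i<j  = walk-segment i<j ∷ʳ walk j
  ... | inj₂ refl = [ walk i ]

  walk-repeats : {Ls : List A} → (∀ i → g i ∈ Ls) → ∃₂ λ i j → i < j × g i ≡ g j
  walk-repeats {Ls} g∈Ls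
    with pigeonhole (n<1+n (length Ls)) (λ k → index (g∈Ls (toℕ k)))
  ... | i , j , i<j , same-index = toℕ i , toℕ j , i<j , g-i≡g-j
    where
    open ≡-Reasoning
    g-i≡g-j : g (toℕ i) ≡ g (toℕ j)
    g-i≡g-j = begin
      g (toℕ i)                        ≡⟨ lookup-index (g∈Ls (toℕ i)) ⟩
      lookup Ls (index (g∈Ls (toℕ i))) ≡⟨ cong (lookup Ls) same-index ⟩
      lookup Ls (index (g∈Ls (toℕ j))) ≡⟨ lookup-index (g∈Ls (toℕ j)) ⟨
      g (toℕ j)                        ∎

  infinite-walk⇒cycle : {Ls : List A} → (∀ {x y} → E x y → x ∈ Ls) →
                        ∃[ x ] TransClosure E x x
  infinite-walk⇒cycle source∈Ls with walk-repeats (λ i → source∈Ls (walk i))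
  ... | i , j , i<j , g-i≡g-j =
    g i , subst (TransClosure E (g i)) (≡-sym g-i≡g-j) (walk-segment i<j)

atomsOf : Rule → List Atom
atomsOf ρ = headAtoms (Rule.head ρ) ++ bodyAtoms (Rule.body ρ)

predSyms : Program → List PredSym
predSyms = concatMap (map predSym ∘ atomsOf)

OccursIn⇒∈predSyms : ∀ {s Π} → OccursIn s Π → s ∈ predSyms Π
OccursIn⇒∈predSyms (ρ , ρ∈Π , a , a∈ρ , refl) =
  ∈-concatMap⁺ (map predSym ∘ atomsOf) (lose ρ∈Π (∈-map⁺ predSym (∈atomsOf a∈ρ)))
  where
  ∈atomsOf : a ∈ headAtoms (Rule.head ρ) ⊎ a ∈ bodyAtoms (Rule.body ρ) → a ∈ atomsOf ρ
  ∈atomsOf (inj₁ a∈head) = ∈-++⁺ˡ a∈head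
  ∈atomsOf (inj₂ a∈body) = ∈-++⁺ʳ _ a∈body

HeadSym : Rule → PredSym → Set
HeadSym ρ s = ∃[ a ] (a ∈ headAtoms (Rule.head ρ) × predSym a ≡ s)

PosBodySym : Rule → PredSym → Set
PosBodySym ρ s = ∃[ a ] (lit (pos a) ∈ Rule.body ρ × predSym a ≡ s)

pos∈⇒∈bodyAtoms : ∀ {a b} → lit (pos a) ∈ b → a ∈ bodyAtoms b
pos∈⇒∈bodyAtoms {b = lit _ ∷ _}      (here refl) = here refl
pos∈⇒∈bodyAtoms {b = lit _ ∷ _}      (there a∈b) = there (pos∈⇒∈bodyAtoms a∈b)
pos∈⇒∈bodyAtoms {b = comp _ _ _ ∷ _} (there a∈b) = pos∈⇒∈bodyAtoms a∈b

rule⇒PredEdge : ∀ {Π ρ s s'} → ρ ∈ Π → HeadSym ρ s → PosBodySym ρ s' → PredEdge Π s s'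
rule⇒PredEdge {ρ = ρ} ρ∈Π (a , a∈ , s≡) (a' , a'∈ , s'≡) =
  (ρ , ρ∈Π , a , inj₁ a∈ , s≡) , (ρ , ρ∈Π , a' , inj₂ (pos∈⇒∈bodyAtoms a'∈) , s'≡) ,
  ρ , ρ∈Π , a , (a∈ , s≡) , a' , a'∈ , s'≡

module _ (f : Term → Term) where

  predSym-mapAtom : ∀ a → predSym (MapTerm.atom f a) ≡ predSym a
  predSym-mapAtom (p ⟨ ts ⟩) = cong (p ,_) (length-map f ts)

  HeadSym-map⁻ : ∀ ρ {s} → HeadSym (MapTerm.rule f ρ) s → HeadSym ρ s
  HeadSym-map⁻ (basic a  ← _) (_ , here refl , s≡) =
    a , here refl , trans (≡-sym (predSym-mapAtom a)) s≡
  HeadSym-map⁻ (choice a ← _) (_ , here refl , s≡) =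
    a , here refl , trans (≡-sym (predSym-mapAtom a)) s≡

  PosBodySym-map⁻ : ∀ ρ {s} → PosBodySym (MapTerm.rule f ρ) s → PosBodySym ρ s
  PosBodySym-map⁻ _ (_ , e∈ , s≡) with ∈-map⁻ (MapTerm.bodyElem f) e∈
  ... | lit (pos a) , a∈ , refl = a , a∈ , trans (≡-sym (predSym-mapAtom a)) s≡

module _ (Ω : IOProgram) (v : SymConst → PTerm) (ℐ : GAtom → Set) where
  open IOProgram Ω
  open LocalTightness Ω v ℐ

  HeadCond⇒HeadSym : ∀ R {A} → HeadCond (Rule.head R) A → HeadSym R (gpredSym A)
  HeadCond⇒HeadSym (basic (p ⟨ _ ⟩)  ← _) (refl , rs∈) =
    _ , here refl , cong (p ,_) (≡-sym (Pointwise-length rs∈))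
  HeadCond⇒HeadSym (choice (p ⟨ _ ⟩) ← _) (refl , rs∈) =
    _ , here refl , cong (p ,_) (≡-sym (Pointwise-length rs∈))

  Edge⇒PredEdge : ∀ {A B} → Edge A B → PredEdge prog (gpredSym A) (gpredSym B)
  Edge⇒PredEdge {B = q ⟨ _ ⟩ᵍ} (_ , _ , _ , (ρ , ρ∈vΠ , σ , refl) , head , ts , (pos∈ , rs∈) , _)
    with ∈-map⁻ (MapTerm.rule (replPH PH v)) ρ∈vΠ
  ... | ρ₀ , ρ₀∈Π , refl =
    rule⇒PredEdge ρ₀∈Π
      (HeadSym-map⁻ (replPH PH v) ρ₀ (HeadSym-map⁻ (substTerm σ) vρ₀
        (HeadCond⇒HeadSym (instRule σ vρ₀) head)))
      (PosBodySym-map⁻ (replPH PH v) ρ₀ (PosBodySym-map⁻ (substTerm σ) vρ₀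
        (_ , pos∈ , cong (q ,_) (≡-sym (Pointwise-length rs∈)))))
    where
    vρ₀ : Rule
    vρ₀ = MapTerm.rule (replPH PH v) ρ₀

proposition1 : (Π : Program) → Tight Π →
    (Ω : IOProgram) → IOProgram.prog Ω ≡ Π →
    (v : SymConst → PTerm) → Valuation (IOProgram.PH Ω) v →
    (ℐ : GAtom → Set) → InputSet (IOProgram.PH Ω) (IOProgram.In Ω) ℐ →
    LocalTightness.LocallyTight Ω v ℐ
proposition1 _ tight Ω refl v _ ℐ _ (f , walk)
  with infinite-walk⇒cycle (gpredSym ∘ f) (Edge⇒PredEdge Ω v ℐ ∘ walk)
                           (OccursIn⇒∈predSyms ∘ proj₁)
... | s , cycle = tight s cycle
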